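{- Let $G=(V,A,s)$ be a flow graph with $n$ vertices, let $T$ be a spanning tree of $G$ rooted at $s$ with parent function $p$, and let the vertices be numbered $1,\dots,n$ in a bottom-up order of $T$ and identified with their numbers. Let $v\neq s$ be a vertex such that no arc entering $v$ is a cross arc or a back arc with respect to $T$, let $(u,v)$ be an arc entering $v$ with $u$ maximum, and suppose $d(p(v))\ge u$. If $u=p(v)$ then $d(v)=u$; otherwise $d(v)=d(p(v))$.
   Context: A flow graph $G=(V,A,s)$ is a finite directed graph (parallel arcs and loop arcs allowed) with start vertex $s$ from which every vertex is reachable. A vertex $x$ dominates $y$ if every path from $s$ to $y$ contains $x$. Every vertex $y\ne s$ has a unique immediate dominator $d(y)\neq y$: a dominator of $y$ such that every dominator of $y$ other than $y$ dominates $d(y)$. $T$ is a spanning tree of $G$ rooted at $s$ (its arcs are arcs of $G$) with parent function $p$. A bottom-up order numbers the vertices with distinct integers $1,\dots,n$ so that $x<p(x)$ for every $x\neq s$. With respect to $T$, an arc $(x,w)$ is a tree arc if $x=p(w)$, a forward arc if $x$ is a proper ancestor of $p(w)$, a back arc if $x$ is a proper descendant of $w$, a cross arc if $x$ and $w$ are unrelated in $T$, and a loop arc if $x=w$. -}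

module Defs where

open import Data.Nat using (ℕ; _<_; _≤_)
open import Data.Fin using (Fin; toℕ)
open import Data.Product using (_×_; _,_)
open import Data.List using (List; []; _∷_)
open import Data.List.Membership.Propositional using (_∈_)
open import Relation.Binary.PropositionalEquality using (_≡_; _≢_)
open import Relation.Nullary using (¬_)

-- A directed multigraph on vertex set Fin n is given by its list of arcs
-- (tail , head); parallel arcs = repeated entries, loop arcs = (x , x).
Arcs : ℕ → Set
Arcs n = List (Fin n × Fin n)

module _ {n : ℕ} (A : Arcs n) where

  data Walk : Fin n → Fin n → Set where
    nil  : (a : Fin n) → Walk a a
    cons : {a b c : Fin n} → (a , b) ∈ A → Walk b c → Walk a c

  verts : {a b : Fin n} → Walk a b → List (Fin n)
  verts (nil a) = a ∷ []
  verts (cons {a} _ w) = a ∷ verts w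

  IsFlowGraph : Fin n → Set
  IsFlowGraph s = (y : Fin n) → Walk s y

  Dominates : Fin n → Fin n → Fin n → Set
  Dominates s x y = (w : Walk s y) → x ∈ verts w

  IsIDom : Fin n → Fin n → Fin n → Set
  IsIDom s y z = Dominates s z y × z ≢ y ×
                 ((x : Fin n) → Dominates s x y → x ≢ y → Dominates s x z)

  -- p is the parent function of a spanning tree T of G rooted at s whose
  -- arcs are arcs of G, and the numbering of vertices (toℕ) is bottom-up for T:
  -- x < p(x) for x ≠ s (this also forces T to be a tree rooted at s).
  IsBottomUpSpanningTree : Fin n → (Fin n → Fin n) → Set
  IsBottomUpSpanningTree s p =
    (x : Fin n) → x ≢ s → ((p x , x) ∈ A) × (toℕ x < toℕ (p x))

module _ {n : ℕ} (s : Fin n) (p : Fin n → Fin n) where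

  data Ancestor (a : Fin n) : Fin n → Set where
    here : Ancestor a a
    up   : {x : Fin n} → x ≢ s → Ancestor a (p x) → Ancestor a x

  BackArc : Fin n → Fin n → Set
  BackArc x w = Ancestor w x × x ≢ w

  CrossArc : Fin n → Fin n → Set
  CrossArc x w = ¬ Ancestor x w × ¬ Ancestor w x

-- The in-neighbours of v other than v itself are ancestors of v, hence lie on the tree path
-- from s to p(v), and u is the highest of them. If u = p(v), every path to v enters it through
-- p(v), so p(v) is the immediate dominator of v. Otherwise d(p(v)) dominates every in-neighbour
-- x of v: a path to x followed by the tree path from x to p(v) meets d(p(v)), and it cannot
-- meet it on the tree path below x because d(p(v)) ≥ u ≥ x. So d(p(v)) dominates v; conversely
-- d(v) dominates p(v) and is different from it (the tree path to u followed by (u, v) avoids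
-- p(v) < u), so d(v) dominates d(p(v)), and the two coincide.
module Submission where

open import Defs
open import Data.Nat using (ℕ; suc; _≤_; _<_; z≤n; s≤s)
open import Data.Nat.Properties using (≤-refl; ≤-trans; <⇒≤; <-≤-trans; <-irrefl; ≤-<-trans)
open import Data.Nat.Induction using (<-wellFounded)
open import Data.Fin using (Fin; toℕ; _>_)
open import Data.Fin.Induction using (>-wellFounded)
open import Data.Fin.Properties using (_≟_; ≤-antisym; <⇒≢; ≤∧≢⇒<)
open import Data.Product using (Σ; ∃; _×_; _,_; proj₁; proj₂)
open import Data.Sum using (_⊎_; inj₁; inj₂)
open import Data.Empty using (⊥; ⊥-elim)
open import Data.List.Relation.Unary.Any using (here; there)
open import Data.List.Membership.Propositional using (_∈_)
open import Function using (_∘_)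
open import Induction.WellFounded using (Acc; acc)
open import Relation.Binary.PropositionalEquality using (_≡_; _≢_; refl; sym; trans; subst)
open import Relation.Nullary using (¬_; Dec; yes; no)
open import Relation.Nullary.Decidable using (map′; decidable-stable)

module Walks {n : ℕ} (A : Arcs n) where

  infixr 5 _++ʷ_

  _++ʷ_ : {a b c : Fin n} → Walk A a b → Walk A b c → Walk A a c
  nil _    ++ʷ w₂ = w₂
  cons e w ++ʷ w₂ = cons e (w ++ʷ w₂)

  length : {a b : Fin n} → Walk A a b → ℕ
  length (nil _)    = 0
  length (cons _ w) = suc (length w)

  length-≤-++ʷ : {a b c : Fin n} (w₁ : Walk A a b) (w₂ : Walk A b c) →
                 length w₁ ≤ length (w₁ ++ʷ w₂)
  length-≤-++ʷ (nil _)    w₂ = z≤n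
  length-≤-++ʷ (cons _ w) w₂ = s≤s (length-≤-++ʷ w w₂)

  length-<-++ʷ : {a b c : Fin n} → b ≢ c → (w₁ : Walk A a b) (w₂ : Walk A b c) →
                 length w₁ < length (w₁ ++ʷ w₂)
  length-<-++ʷ b≢c (nil _)    (nil _)    = ⊥-elim (b≢c refl)
  length-<-++ʷ b≢c (nil _)    (cons _ _) = s≤s z≤n
  length-<-++ʷ b≢c (cons _ w) w₂         = s≤s (length-<-++ʷ b≢c w w₂)

  end∈verts : {a b : Fin n} (w : Walk A a b) → b ∈ verts A w
  end∈verts (nil _)    = here refl
  end∈verts (cons _ w) = there (end∈verts w)

  ∈-verts-++ʷˡ : {a b c z : Fin n} (w₁ : Walk A a b) (w₂ : Walk A b c) →
                 z ∈ verts A w₁ → z ∈ verts A (w₁ ++ʷ w₂)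
  ∈-verts-++ʷˡ (nil _)    w₂ (here refl) = start∈verts w₂
    where
    start∈verts : {a c : Fin n} (w : Walk A a c) → a ∈ verts A w
    start∈verts (nil _)    = here refl
    start∈verts (cons _ _) = here refl
  ∈-verts-++ʷˡ (cons _ w) w₂ (here eq)   = here eq
  ∈-verts-++ʷˡ (cons _ w) w₂ (there z∈w) = there (∈-verts-++ʷˡ w w₂ z∈w)

  ∈-verts-++ʷ⁻ : {a b c z : Fin n} (w₁ : Walk A a b) (w₂ : Walk A b c) →
                 z ∈ verts A (w₁ ++ʷ w₂) → z ∈ verts A w₁ ⊎ z ∈ verts A w₂
  ∈-verts-++ʷ⁻ (nil _)    w₂ z∈w₂       = inj₂ z∈w₂
  ∈-verts-++ʷ⁻ (cons _ w) w₂ (here eq)  = inj₁ (here eq)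
  ∈-verts-++ʷ⁻ (cons _ w) w₂ (there z∈) with ∈-verts-++ʷ⁻ w w₂ z∈
  ... | inj₁ z∈w  = inj₁ (there z∈w)
  ... | inj₂ z∈w₂ = inj₂ z∈w₂

  splitAt : {a b z : Fin n} (w : Walk A a b) → z ∈ verts A w →
            Σ (Walk A a z) λ w₁ → Σ (Walk A z b) λ w₂ → w₁ ++ʷ w₂ ≡ w
  splitAt (nil a)        (here refl) = nil a , nil a , refl
  splitAt (cons {a} e w) (here refl) = nil a , cons e w , refl
  splitAt (cons e w)     (there z∈w) with splitAt w z∈w
  ... | w₁ , w₂ , refl = cons e w₁ , w₂ , refl

  in-neighbour-on-walk : {a v : Fin n} → a ≢ v → (w : Walk A a v) →
              ∃ λ x → (x , v) ∈ A × x ≢ v × x ∈ verts A w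
  in-neighbour-on-walk a≢v (nil _) = ⊥-elim (a≢v refl)
  in-neighbour-on-walk {v = v} a≢v (cons {a} {b} e w) with b ≟ v
  ... | yes refl = a , e , a≢v , here refl
  ... | no b≢v with in-neighbour-on-walk b≢v w
  ...   | x , x→v , x≢v , x∈w = x , x→v , x≢v , there x∈w

module Domination {n : ℕ} {A : Arcs n} {s : Fin n} where

  open Walks A

  dominates-refl : (x : Fin n) → Dominates A s x x
  dominates-refl x = end∈verts

  dominates-in-neighbour : {z y x : Fin n} → Dominates A s z y → z ≢ y →
                           (x , y) ∈ A → Dominates A s z x
  dominates-in-neighbour {z} {y} z-dom-y z≢y x→y w
    with ∈-verts-++ʷ⁻ w (cons x→y (nil y)) (z-dom-y (w ++ʷ cons x→y (nil y)))
  ... | inj₁ z∈w                = z∈w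
  ... | inj₂ (here refl)        = end∈verts w
  ... | inj₂ (there (here z≡y)) = ⊥-elim (z≢y z≡y)

  dominates-via-in-neighbours : {z v : Fin n} → s ≢ v →
    ((x : Fin n) → (x , v) ∈ A → x ≢ v → Dominates A s z x) → Dominates A s z v
  dominates-via-in-neighbours s≢v z-dom-in w with in-neighbour-on-walk s≢v w
  ... | x , x→v , x≢v , x∈w with splitAt w x∈w
  ...   | w₁ , w₂ , refl = ∈-verts-++ʷˡ w₁ w₂ (z-dom-in x x→v x≢v w₁)

  -- A shortest walk from s to x would pass through y and then again through x.
  dominates-antisym : IsFlowGraph A s → {x y : Fin n} →
                      Dominates A s x y → Dominates A s y x → x ≡ y
  dominates-antisym reach {x} {y} x-dom-y y-dom-x with x ≟ y
  ... | yes x≡y = x≡y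
  ... | no x≢y  = ⊥-elim (noWalk (reach x) (<-wellFounded _))
    where
    noWalk : (w : Walk A s x) → Acc _<_ (length w) → ⊥
    noWalk w (acc shorter) with splitAt w (y-dom-x w)
    ... | w₁ , w₂ , refl with splitAt w₁ (x-dom-y w₁)
    ...   | w₃ , w₄ , refl = noWalk w₃ (shorter (≤-<-trans (length-≤-++ʷ w₃ w₄)
                                                  (length-<-++ʷ (x≢y ∘ sym) (w₃ ++ʷ w₄) w₂)))

  idom≡ : {v z t : Fin n} → IsFlowGraph A s → IsIDom A s v z →
          Dominates A s t v → t ≢ v → Dominates A s z t → z ≡ t
  idom≡ reach (_ , _ , below-idom) t-dom-v t≢v z-dom-t =
    dominates-antisym reach z-dom-t (below-idom _ t-dom-v t≢v)

module Tree {n : ℕ} {A : Arcs n} {s : Fin n} {p : Fin n → Fin n}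
            (tree : IsBottomUpSpanningTree A s p) where

  open Walks A

  parent-arc : {x : Fin n} → x ≢ s → (p x , x) ∈ A
  parent-arc x≢s = proj₁ (tree _ x≢s)

  <-parent : {x : Fin n} → x ≢ s → toℕ x < toℕ (p x)
  <-parent x≢s = proj₂ (tree _ x≢s)

  ancestor⇒≤ : {a y : Fin n} → Ancestor s p a y → toℕ y ≤ toℕ a
  ancestor⇒≤ here          = ≤-refl
  ancestor⇒≤ (up y≢s a↑py) = <⇒≤ (<-≤-trans (<-parent y≢s) (ancestor⇒≤ a↑py))

  ancestor-of-root : {a : Fin n} → Ancestor s p a s → a ≡ s
  ancestor-of-root here       = refl
  ancestor-of-root (up s≢s _) = ⊥-elim (s≢s refl)

  -- Going up the tree strictly increases the number, so _>_ on Fin n is the measure.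
  root-ancestor : (y : Fin n) → Ancestor s p s y
  root-ancestor y = go y (>-wellFounded y)
    where
    go : (y : Fin n) → Acc _>_ y → Ancestor s p s y
    go y (acc higher) with y ≟ s
    ... | yes refl = here
    ... | no y≢s   = up y≢s (go (p y) (higher (<-parent y≢s)))

  ancestor? : (a y : Fin n) → Dec (Ancestor s p a y)
  ancestor? a y = go y (>-wellFounded y)
    where
    go : (y : Fin n) → Acc _>_ y → Dec (Ancestor s p a y)
    go y (acc higher) with a ≟ y
    ... | yes refl = yes here
    ... | no a≢y with y ≟ s
    ...   | yes refl = no (a≢y ∘ ancestor-of-root)
    ...   | no y≢s   = map′ (up y≢s) parent-of (go (p y) (higher (<-parent y≢s)))
      where
      parent-of : Ancestor s p a y → Ancestor s p a (p y)
      parent-of here        = ⊥-elim (a≢y refl)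
      parent-of (up _ a↑py) = a↑py

  treeWalk : {a y : Fin n} → Ancestor s p a y → Walk A a y
  treeWalk here          = nil _
  treeWalk (up y≢s a↑py) = treeWalk a↑py ++ʷ cons (parent-arc y≢s) (nil _)

  ∈-treeWalk⇒between : {a y z : Fin n} (a↑y : Ancestor s p a y) →
                       z ∈ verts A (treeWalk a↑y) → Ancestor s p a z × Ancestor s p z y
  ∈-treeWalk⇒between here (here refl) = here , here
  ∈-treeWalk⇒between (up y≢s a↑py) z∈
    with ∈-verts-++ʷ⁻ (treeWalk a↑py) (cons (parent-arc y≢s) (nil _)) z∈
  ... | inj₁ z∈walk with ∈-treeWalk⇒between a↑py z∈walk
  ...   | a↑z , z↑py = a↑z , up y≢s z↑py
  ∈-treeWalk⇒between (up y≢s a↑py) z∈ | inj₂ (here refl)         = a↑py , up y≢s here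
  ∈-treeWalk⇒between (up y≢s a↑py) z∈ | inj₂ (there (here refl)) = up y≢s a↑py , here

  open Domination {A = A} {s = s}

  -- A walk to x continued down the tree to y can only meet z on the tree part at x itself.
  dominates-ancestor : {z x y : Fin n} → Dominates A s z y → Ancestor s p x y →
                       toℕ x ≤ toℕ z → Dominates A s z x
  dominates-ancestor {z} {x} z-dom-y x↑y x≤z w
    with ∈-verts-++ʷ⁻ w (treeWalk x↑y) (z-dom-y (w ++ʷ treeWalk x↑y))
  ... | inj₁ z∈w    = z∈w
  ... | inj₂ z∈tree = subst (_∈ verts A w) (sym z≡x) (end∈verts w)
    where
    z≡x : z ≡ x
    z≡x = ≤-antisym (ancestor⇒≤ (proj₁ (∈-treeWalk⇒between x↑y z∈tree))) x≤z

  ¬dominates-below-in-neighbour : {t u v : Fin n} → (u , v) ∈ A → toℕ t < toℕ u → t ≢ v →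
                                  ¬ Dominates A s t v
  ¬dominates-below-in-neighbour {t} {u} {v} u→v t<u t≢v t-dom-v
    with ∈-verts-++ʷ⁻ (treeWalk (root-ancestor u)) (cons u→v (nil v))
                      (t-dom-v (treeWalk (root-ancestor u) ++ʷ cons u→v (nil v)))
  ... | inj₁ t∈tree = <-irrefl refl (<-≤-trans t<u
                        (ancestor⇒≤ (proj₂ (∈-treeWalk⇒between (root-ancestor u) t∈tree))))
  ... | inj₂ (here refl)        = <⇒≢ t<u refl
  ... | inj₂ (there (here t≡v)) = t≢v t≡v

  in-neighbour⇒ancestor-of-parent : {x v : Fin n} → ¬ CrossArc s p x v → ¬ BackArc s p x v →
                                    x ≢ v → Ancestor s p x (p v)
  in-neighbour⇒ancestor-of-parent {x} {v} ¬cross ¬back x≢v with x↑v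
    where
    x↑v : Ancestor s p x v
    x↑v = decidable-stable (ancestor? x v) λ ¬x↑v → ¬cross (¬x↑v , λ v↑x → ¬back (v↑x , x≢v))
  ... | here       = ⊥-elim (x≢v refl)
  ... | up _ x↑pv = x↑pv

module NoCrossOrBackEntry
  {n : ℕ} {A : Arcs n} {s : Fin n} {p d : Fin n → Fin n}
  (reach : IsFlowGraph A s) (tree : IsBottomUpSpanningTree A s p)
  (idom : (y : Fin n) → y ≢ s → IsIDom A s y (d y))
  {v : Fin n} (v≢s : v ≢ s)
  (entries : (x : Fin n) → (x , v) ∈ A → ¬ CrossArc s p x v × ¬ BackArc s p x v) where

  open Domination {A = A} {s = s}
  open Tree tree

  ancestor-of-pv : (x : Fin n) → (x , v) ∈ A → x ≢ v → Ancestor s p x (p v)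
  ancestor-of-pv x x→v = in-neighbour⇒ancestor-of-parent (proj₁ (entries x x→v)) (proj₂ (entries x x→v))

  dv-dom-v : Dominates A s (d v) v
  dv-dom-v = proj₁ (idom v v≢s)

  dv-dom-pv : Dominates A s (d v) (p v)
  dv-dom-pv = dominates-in-neighbour dv-dom-v (proj₁ (proj₂ (idom v v≢s))) (parent-arc v≢s)

  pv≢v : p v ≢ v
  pv≢v = <⇒≢ (<-parent v≢s) ∘ sym

  idom≡parent : ((x : Fin n) → (x , v) ∈ A → toℕ x ≤ toℕ (p v)) → d v ≡ p v
  idom≡parent ≤pv = idom≡ reach (idom v v≢s) (dominates-via-in-neighbours (v≢s ∘ sym) only-pv) pv≢v dv-dom-pv
    where
    only-pv : (x : Fin n) → (x , v) ∈ A → x ≢ v → Dominates A s (p v) x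
    only-pv x x→v x≢v with ≤-antisym (≤pv x x→v) (ancestor⇒≤ (ancestor-of-pv x x→v x≢v))
    ... | refl = dominates-refl x

  idom≡idom-of-parent : {u : Fin n} → (u , v) ∈ A → ((x : Fin n) → (x , v) ∈ A → toℕ x ≤ toℕ u) →
                        u ≢ p v → toℕ u ≤ toℕ (d (p v)) → d v ≡ d (p v)
  idom≡idom-of-parent {u} u→v u-max u≢pv u≤dpv = idom≡ reach (idom v v≢s) dpv-dom-v dpv≢v dv-dom-dpv
    where
    pv<u : toℕ (p v) < toℕ u
    pv<u = ≤∧≢⇒< (u-max (p v) (parent-arc v≢s)) (u≢pv ∘ sym)

    v<u : toℕ v < toℕ u
    v<u = <-≤-trans (<-parent v≢s) (<⇒≤ pv<u)

    pv≢s : p v ≢ s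
    pv≢s pv≡s = u≢pv (trans (ancestor-of-root (subst (Ancestor s p u) pv≡s u↑pv)) (sym pv≡s))
      where
      u↑pv : Ancestor s p u (p v)
      u↑pv = ancestor-of-pv u u→v (<⇒≢ v<u ∘ sym)

    dpv-dom-v : Dominates A s (d (p v)) v
    dpv-dom-v = dominates-via-in-neighbours (v≢s ∘ sym) λ x x→v x≢v →
      dominates-ancestor (proj₁ (idom (p v) pv≢s)) (ancestor-of-pv x x→v x≢v)
                         (≤-trans (u-max x x→v) u≤dpv)

    dpv≢v : d (p v) ≢ v
    dpv≢v = <⇒≢ (<-≤-trans v<u u≤dpv) ∘ sym

    dv≢pv : d v ≢ p v
    dv≢pv dv≡pv = ¬dominates-below-in-neighbour u→v pv<u pv≢v
                    (subst (λ t → Dominates A s t v) dv≡pv dv-dom-v)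

    dv-dom-dpv : Dominates A s (d v) (d (p v))
    dv-dom-dpv = proj₂ (proj₂ (idom (p v) pv≢s)) (d v) dv-dom-pv dv≢pv

lemma2 : {n : ℕ} (A : Arcs n) (s : Fin n) (p : Fin n → Fin n) (d : Fin n → Fin n)
    → IsFlowGraph A s
    → IsBottomUpSpanningTree A s p
    → ((y : Fin n) → y ≢ s → IsIDom A s y (d y))
    → (v u : Fin n) → v ≢ s
    → ((x : Fin n) → (x , v) ∈ A → ¬ CrossArc s p x v × ¬ BackArc s p x v)
    → (u , v) ∈ A
    → ((x : Fin n) → (x , v) ∈ A → toℕ x ≤ toℕ u)
    → toℕ u ≤ toℕ (d (p v))
    → (u ≡ p v → d v ≡ u) × (u ≢ p v → d v ≡ d (p v))
lemma2 A s p d reach tree idom v u v≢s entries u→v u-max u≤dpv =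
  (λ { refl → idom≡parent u-max }) ,
  (λ u≢pv → idom≡idom-of-parent u→v u-max u≢pv u≤dpv)
  where open NoCrossOrBackEntry reach tree idom v≢s entries
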